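{- Let $G$ be a connected graph and $k\ge 1$ an integer. Then $\mathrm{diam}(G)\le 2k+1$ if and only if every $k$-packing of $G$ is a general position set.
   Context: A set $S$ of vertices of $G$ is a $k$-packing if $d_G(u,v)>k$ for all distinct $u,v\in S$. A set $S\subseteq V(G)$ is a general position set if no three distinct vertices of $S$ lie on a common geodesic (shortest path) of $G$. $\mathrm{diam}(G)$ is the maximum distance between two vertices of $G$. -}

module Defs where

open import Data.Nat using (ℕ; zero; suc; _≤_; _<_)
open import Data.Fin using (Fin)
open import Data.Fin.Subset using (Subset; _∈_)
open import Data.Bool using (Bool; true; false)
open import Data.Product using (Σ; _×_; ∃; ∃-syntax)
open import Relation.Binary.PropositionalEquality using (_≡_; _≢_)
open import Relation.Nullary using (¬_)

record Graph : Set where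
  field
    n     : ℕ
    adj   : Fin n → Fin n → Bool
    sym   : ∀ u v → adj u v ≡ adj v u
    irrefl : ∀ u → adj u u ≡ false

open Graph public

Vertex : Graph → Set
Vertex G = Fin (n G)

Adj : (G : Graph) → Vertex G → Vertex G → Set
Adj G u v = adj G u v ≡ true

data Walk (G : Graph) : Vertex G → Vertex G → ℕ → Set where
  [_]  : (u : Vertex G) → Walk G u u zero
  _∷_  : ∀ {u w v ℓ} → Adj G u w → Walk G w v ℓ → Walk G u v (suc ℓ)

data OnWalk (G : Graph) (x : Vertex G) : ∀ {u v ℓ} → Walk G u v ℓ → Set where
  here-end : OnWalk G x [ x ]
  here     : ∀ {w v ℓ} (e : Adj G x w) (p : Walk G w v ℓ) → OnWalk G x (e ∷ p)
  there    : ∀ {u w v ℓ} (e : Adj G u w) {p : Walk G w v ℓ} →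
             OnWalk G x p → OnWalk G x (e ∷ p)

Distance : (G : Graph) → Vertex G → Vertex G → ℕ → Set
Distance G u v d = Walk G u v d × (∀ ℓ → Walk G u v ℓ → d ≤ ℓ)

Connected : Graph → Set
Connected G = ∀ (u v : Vertex G) → ∃[ ℓ ] Walk G u v ℓ

DiamAtMost : Graph → ℕ → Set
DiamAtMost G D = ∀ (u v : Vertex G) (d : ℕ) → Distance G u v d → d ≤ D

IsGeodesic : (G : Graph) {u v : Vertex G} {ℓ : ℕ} → Walk G u v ℓ → Set
IsGeodesic G {u} {v} {ℓ} _ = Distance G u v ℓ

IsKPacking : (G : Graph) → ℕ → Subset (n G) → Set
IsKPacking G k S = ∀ (u v : Vertex G) → u ∈ S → v ∈ S → u ≢ v →
                   ∀ d → Distance G u v d → k < d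

OnCommonGeodesic : (G : Graph) → Vertex G → Vertex G → Vertex G → Set
OnCommonGeodesic G x y z =
  Σ (Vertex G) λ u → Σ (Vertex G) λ v → Σ ℕ λ ℓ → Σ (Walk G u v ℓ) λ p →
    IsGeodesic G p × OnWalk G x p × OnWalk G y p × OnWalk G z p

IsGeneralPosition : (G : Graph) → Subset (n G) → Set
IsGeneralPosition G S = ∀ (x y z : Vertex G) → x ∈ S → y ∈ S → z ∈ S →
  x ≢ y → y ≢ z → x ≢ z → ¬ OnCommonGeodesic G x y z

-- Three vertices lie on a common geodesic exactly when one of them, y, lies
-- between the others: d(x,z) = d(x,y) + d(y,z).  If diam G ≤ 2k + 1, no
-- vertex of a k-packing can lie between two others, since that would need
-- d(x,z) ≥ (k + 1) + (k + 1).  Conversely, on a geodesic of length at least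
-- 2k + 2 its two ends and the vertex at position k + 1 form a k-packing that
-- is not in general position.
module Submission where

open import Defs
open import Data.Nat using (ℕ; _+_; _*_; _≤_)
open import Data.Fin.Subset using (Subset)
open import Function.Bundles using (_⇔_)

open import Data.Nat using (zero; suc; _∸_; _<_; z≤n; s≤s; _≤?_)
open import Data.Nat.Properties
open import Data.Nat.Tactic.RingSolver using (solve-∀)
open import Data.Fin.Subset using (_∈_; ⁅_⁆; _∪_)
open import Data.Fin.Subset.Properties using (x∈⁅x⁆; x∈⁅y⁆⇒x≡y; x∈p∪q⁻; x∈p∪q⁺)
open import Data.Product using (Σ; _×_; _,_; ∃₂)
open import Data.Sum using (_⊎_; inj₁; inj₂)
open import Data.Empty using (⊥-elim)
open import Relation.Nullary using (¬_; yes; no)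
open import Relation.Binary.PropositionalEquality
  using (_≡_; _≢_; refl; trans; cong; subst; module ≡-Reasoning)
  renaming (sym to ≡-sym)
open import Function.Bundles using (mk⇔)

∸-+-∸ : ∀ {i j l} → i ≤ j → j ≤ l → (j ∸ i) + (l ∸ j) ≡ l ∸ i
∸-+-∸ {i} {j} {l} i≤j j≤l = begin
  (j ∸ i) + (l ∸ j)  ≡⟨ +-comm (j ∸ i) (l ∸ j) ⟩
  (l ∸ j) + (j ∸ i)  ≡⟨ +-∸-assoc (l ∸ j) i≤j ⟨
  (l ∸ j + j) ∸ i    ≡⟨ cong (_∸ i) (m∸n+n≡m j≤l) ⟩
  l ∸ i              ∎
  where open ≡-Reasoning

1+k+1+k≡1+[2k+1] : ∀ k → suc k + suc k ≡ suc (2 * k + 1)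
1+k+1+k≡1+[2k+1] = solve-∀

module _ (G : Graph) where

  adj-sym : ∀ {u v} → Adj G u v → Adj G v u
  adj-sym {u} {v} e = trans (Graph.sym G v u) e

  _++_ : ∀ {u w v i j} → Walk G u w i → Walk G w v j → Walk G u v (i + j)
  [ u ]   ++ q = q
  (e ∷ p) ++ q = e ∷ (p ++ q)

  reverse : ∀ {u v ℓ} → Walk G u v ℓ → Walk G v u ℓ
  reverse [ u ] = [ u ]
  reverse {u} (_∷_ {ℓ = ℓ} e p) =
    subst (Walk G _ u) (+-comm ℓ 1) (reverse p ++ (adj-sym e ∷ [ u ]))

  distance-sym : ∀ {u v d} → Distance G u v d → Distance G v u d
  distance-sym (p , minimal) = reverse p , λ ℓ q → minimal ℓ (reverse q)

  distance-unique : ∀ {u v d e} → Distance G u v d → Distance G u v e → d ≡ e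
  distance-unique (p , minimal-p) (q , minimal-q) =
    ≤-antisym (minimal-p _ q) (minimal-q _ p)

  distance>0⇒≢ : ∀ {u v d} → Distance G u v d → 0 < d → u ≢ v
  distance>0⇒≢ {u} (_ , minimal) 0<d refl = <⇒≱ 0<d (minimal 0 [ u ])

  -- Positions past the end of the walk give its last vertex.
  vertexAt : ∀ {u v ℓ} → Walk G u v ℓ → ℕ → Vertex G
  vertexAt {u} p       zero    = u
  vertexAt     [ u ]   (suc i) = u
  vertexAt     (e ∷ p) (suc i) = vertexAt p i

  take : ∀ {u v ℓ} (p : Walk G u v ℓ) j → j ≤ ℓ → Walk G u (vertexAt p j) j
  take {u} p       zero    _         = [ u ]
  take     (e ∷ p) (suc j) (s≤s j≤ℓ) = e ∷ take p j j≤ℓ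

  drop : ∀ {u v ℓ} (p : Walk G u v ℓ) i → Walk G (vertexAt p i) v (ℓ ∸ i)
  drop p       zero    = p
  drop [ u ]   (suc i) = [ u ]
  drop (e ∷ p) (suc i) = drop p i

  vertexAt-drop : ∀ {u v ℓ} (p : Walk G u v ℓ) i m →
                  vertexAt (drop p i) m ≡ vertexAt p (i + m)
  vertexAt-drop p       zero    m       = refl
  vertexAt-drop [ u ]   (suc i) zero    = refl
  vertexAt-drop [ u ]   (suc i) (suc m) = refl
  vertexAt-drop (e ∷ p) (suc i) m       = vertexAt-drop p i m

  segment : ∀ {u v ℓ} (p : Walk G u v ℓ) {i j} → i ≤ j → j ≤ ℓ →
            Walk G (vertexAt p i) (vertexAt p j) (j ∸ i)
  segment p {i} {j} i≤j j≤ℓ =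
    subst (λ w → Walk G (vertexAt p i) w (j ∸ i))
      (trans (vertexAt-drop p i (j ∸ i)) (cong (vertexAt p) (m+[n∸m]≡n i≤j)))
      (take (drop p i) (j ∸ i) (∸-monoˡ-≤ i j≤ℓ))

  -- A shorter detour between positions i and j would shorten the whole geodesic.
  segment-distance : ∀ {u v ℓ} (p : Walk G u v ℓ) → Distance G u v ℓ → ∀ {i j} →
                     (i≤j : i ≤ j) (j≤ℓ : j ≤ ℓ) →
                     Distance G (vertexAt p i) (vertexAt p j) (j ∸ i)
  segment-distance {ℓ = ℓ} p (_ , minimal) {i} {j} i≤j j≤ℓ =
    segment p i≤j j≤ℓ , λ m q → m≤n+o⇒m∸n≤o j i (j≤i+m q)
    where
    j≤i+m : ∀ {m} → Walk G (vertexAt p i) (vertexAt p j) m → j ≤ i + m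
    j≤i+m {m} q = +-cancelʳ-≤ (ℓ ∸ j) j (i + m)
      (subst (_≤ i + m + (ℓ ∸ j)) (≡-sym (m+[n∸m]≡n j≤ℓ))
        (minimal _ ((take p i (≤-trans i≤j j≤ℓ) ++ q) ++ drop p j)))

  onWalk⇒vertexAt : ∀ {x u v ℓ} {p : Walk G u v ℓ} → OnWalk G x p →
                    Σ ℕ λ i → i ≤ ℓ × vertexAt p i ≡ x
  onWalk⇒vertexAt here-end     = 0 , z≤n , refl
  onWalk⇒vertexAt (here e p)   = 0 , z≤n , refl
  onWalk⇒vertexAt (there e x∈p) with onWalk⇒vertexAt x∈p
  ... | i , i≤ℓ , eq = suc i , s≤s i≤ℓ , eq

  vertexAt-onWalk : ∀ {u v ℓ} (p : Walk G u v ℓ) {i} → i ≤ ℓ → OnWalk G (vertexAt p i) p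
  vertexAt-onWalk [ u ]   {zero}  _         = here-end
  vertexAt-onWalk (e ∷ p) {zero}  _         = here e p
  vertexAt-onWalk (e ∷ p) {suc i} (s≤s i≤ℓ) = there e (vertexAt-onWalk p i≤ℓ)

  Between : Vertex G → Vertex G → Vertex G → ℕ → ℕ → Set
  Between x y z a b = Distance G x y a × Distance G y z b × Distance G x z (a + b)

  between-sym : ∀ {x y z a b} → Between x y z a b → Between z y x b a
  between-sym {a = a} {b} (xy , yz , xz) =
    distance-sym yz , distance-sym xy , subst (Distance G _ _) (+-comm a b) (distance-sym xz)

  vertexAt-between : ∀ {u v ℓ} (p : Walk G u v ℓ) → Distance G u v ℓ → ∀ {i j l} →
                     i ≤ j → j ≤ l → l ≤ ℓ →
                     Between (vertexAt p i) (vertexAt p j) (vertexAt p l) (j ∸ i) (l ∸ j)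
  vertexAt-between p geodesic i≤j j≤l l≤ℓ =
      segment-distance p geodesic i≤j (≤-trans j≤l l≤ℓ)
    , segment-distance p geodesic j≤l l≤ℓ
    , subst (Distance G _ _) (≡-sym (∸-+-∸ i≤j j≤l))
        (segment-distance p geodesic (≤-trans i≤j j≤l) l≤ℓ)

  onCommonGeodesic⇒between : ∀ {x y z} → OnCommonGeodesic G x y z →
    ∃₂ (Between x y z) ⊎ ∃₂ (Between y x z) ⊎ ∃₂ (Between x z y)
  onCommonGeodesic⇒between (_ , _ , ℓ , p , geodesic , x∈p , y∈p , z∈p) =
    sort (onWalk⇒vertexAt x∈p) (onWalk⇒vertexAt y∈p) (onWalk⇒vertexAt z∈p)
    where
    Position : Vertex G → Set
    Position x = Σ ℕ λ i → i ≤ ℓ × vertexAt p i ≡ x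

    ordered : ∀ {i j l} → i ≤ j → j ≤ l → l ≤ ℓ →
              Between (vertexAt p i) (vertexAt p j) (vertexAt p l) (j ∸ i) (l ∸ j)
    ordered = vertexAt-between p geodesic

    sort : ∀ {x y z} → Position x → Position y → Position z →
           ∃₂ (Between x y z) ⊎ ∃₂ (Between y x z) ⊎ ∃₂ (Between x z y)
    sort (i , i≤ℓ , refl) (j , j≤ℓ , refl) (l , l≤ℓ , refl)
      with ≤-total i j | ≤-total j l | ≤-total i l
    ... | inj₁ i≤j | inj₁ j≤l | _        = inj₁ (_ , _ , ordered i≤j j≤l l≤ℓ)
    ... | inj₁ i≤j | inj₂ l≤j | inj₁ i≤l = inj₂ (inj₂ (_ , _ , ordered i≤l l≤j j≤ℓ))
    ... | inj₁ i≤j | inj₂ l≤j | inj₂ l≤i = inj₂ (inj₁ (_ , _ , between-sym (ordered l≤i i≤j j≤ℓ)))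
    ... | inj₂ j≤i | _        | inj₁ i≤l = inj₂ (inj₁ (_ , _ , ordered j≤i i≤l l≤ℓ))
    ... | inj₂ j≤i | inj₁ j≤l | inj₂ l≤i = inj₂ (inj₂ (_ , _ , between-sym (ordered j≤l l≤i i≤ℓ)))
    ... | inj₂ j≤i | inj₂ l≤j | inj₂ _   = inj₁ (_ , _ , between-sym (ordered l≤j j≤i i≤ℓ))

  vertexAt-length : ∀ {u v ℓ} (p : Walk G u v ℓ) → vertexAt p ℓ ≡ v
  vertexAt-length [ u ]   = refl
  vertexAt-length (e ∷ p) = vertexAt-length p

  vertexAt-++ : ∀ {u w v i j} (p : Walk G u w i) (q : Walk G w v j) → vertexAt (p ++ q) i ≡ w
  vertexAt-++ [ u ]   q = refl
  vertexAt-++ (e ∷ p) q = vertexAt-++ p q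

  between⇒onCommonGeodesic : ∀ {x y z a b} → Between x y z a b → OnCommonGeodesic G x y z
  between⇒onCommonGeodesic {a = a} {b} ((p , _) , (q , _) , (_ , minimal)) =
      _ , _ , _ , p ++ q , (p ++ q , minimal)
    , vertexAt-onWalk (p ++ q) z≤n
    , subst (λ w → OnWalk G w (p ++ q)) (vertexAt-++ p q) (vertexAt-onWalk (p ++ q) (m≤m+n a b))
    , subst (λ w → OnWalk G w (p ++ q)) (vertexAt-length (p ++ q)) (vertexAt-onWalk (p ++ q) ≤-refl)

  module _ {k : ℕ} where

    packing-¬between : DiamAtMost G (2 * k + 1) → ∀ {S} → IsKPacking G k S →
      ∀ {x y z a b} → x ∈ S → y ∈ S → z ∈ S → x ≢ y → y ≢ z → ¬ Between x y z a b
    packing-¬between diam packing x∈S y∈S z∈S x≢y y≢z (xy , yz , xz) =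
      <-irrefl refl (subst (_≤ 2 * k + 1) (1+k+1+k≡1+[2k+1] k)
        (≤-trans (+-mono-≤ (packing _ _ x∈S y∈S x≢y _ xy) (packing _ _ y∈S z∈S y≢z _ yz))
                 (diam _ _ _ xz)))

    diam⇒packing⇒generalPosition : DiamAtMost G (2 * k + 1) →
      ∀ S → IsKPacking G k S → IsGeneralPosition G S
    diam⇒packing⇒generalPosition diam S packing x y z x∈S y∈S z∈S x≢y y≢z x≢z common
      with onCommonGeodesic⇒between common
    ... | inj₁ (_ , _ , β) =
      packing-¬between diam packing x∈S y∈S z∈S x≢y y≢z β
    ... | inj₂ (inj₁ (_ , _ , β)) =
      packing-¬between diam packing y∈S x∈S z∈S (λ e → x≢y (≡-sym e)) x≢z β
    ... | inj₂ (inj₂ (_ , _ , β)) =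
      packing-¬between diam packing x∈S z∈S y∈S x≢z (λ e → y≢z (≡-sym e)) β

  triple : Vertex G → Vertex G → Vertex G → Subset (n G)
  triple x y z = ⁅ x ⁆ ∪ ⁅ y ⁆ ∪ ⁅ z ⁆

  ∈-triple⁻ : ∀ x y z {w} → w ∈ triple x y z → w ≡ x ⊎ w ≡ y ⊎ w ≡ z
  ∈-triple⁻ x y z w∈S with x∈p∪q⁻ ⁅ x ⁆ _ w∈S
  ... | inj₁ w∈x = inj₁ (x∈⁅y⁆⇒x≡y x w∈x)
  ... | inj₂ w∈yz with x∈p∪q⁻ ⁅ y ⁆ _ w∈yz
  ... | inj₁ w∈y = inj₂ (inj₁ (x∈⁅y⁆⇒x≡y y w∈y))
  ... | inj₂ w∈z = inj₂ (inj₂ (x∈⁅y⁆⇒x≡y z w∈z))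

  x∈triple : ∀ x y z → x ∈ triple x y z
  x∈triple x y z = x∈p∪q⁺ (inj₁ (x∈⁅x⁆ x))

  y∈triple : ∀ x y z → y ∈ triple x y z
  y∈triple x y z = x∈p∪q⁺ {p = ⁅ x ⁆} (inj₂ (x∈p∪q⁺ (inj₁ (x∈⁅x⁆ y))))

  z∈triple : ∀ x y z → z ∈ triple x y z
  z∈triple x y z = x∈p∪q⁺ {p = ⁅ x ⁆} (inj₂ (x∈p∪q⁺ {p = ⁅ y ⁆} (inj₂ (x∈⁅x⁆ z))))

  between-packing : ∀ {k x y z a b} → Between x y z a b → k < a → k < b →
                    IsKPacking G k (triple x y z)
  between-packing {k} {x} {y} {z} {a} {b} (xy , yz , xz) k<a k<b u v u∈S v∈S u≢v d uv
    with far (∈-triple⁻ x y z u∈S) (∈-triple⁻ x y z v∈S) u≢v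
    where
    k<a+b : k < a + b
    k<a+b = ≤-trans k<a (m≤m+n a b)
    far : ∀ {u v} → u ≡ x ⊎ u ≡ y ⊎ u ≡ z → v ≡ x ⊎ v ≡ y ⊎ v ≡ z → u ≢ v →
          Σ ℕ λ e → Distance G u v e × k < e
    far (inj₁ refl)        (inj₁ refl)        u≢v = ⊥-elim (u≢v refl)
    far (inj₁ refl)        (inj₂ (inj₁ refl)) _   = _ , xy , k<a
    far (inj₁ refl)        (inj₂ (inj₂ refl)) _   = _ , xz , k<a+b
    far (inj₂ (inj₁ refl)) (inj₁ refl)        _   = _ , distance-sym xy , k<a
    far (inj₂ (inj₁ refl)) (inj₂ (inj₁ refl)) u≢v = ⊥-elim (u≢v refl)
    far (inj₂ (inj₁ refl)) (inj₂ (inj₂ refl)) _   = _ , yz , k<b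
    far (inj₂ (inj₂ refl)) (inj₁ refl)        _   = _ , distance-sym xz , k<a+b
    far (inj₂ (inj₂ refl)) (inj₂ (inj₁ refl)) _   = _ , distance-sym yz , k<b
    far (inj₂ (inj₂ refl)) (inj₂ (inj₂ refl)) u≢v = ⊥-elim (u≢v refl)
  ... | e , uv′ , k<e = subst (k <_) (distance-unique uv′ uv) k<e

  between⇒¬generalPosition : ∀ {x y z a b} → Between x y z a b → 0 < a → 0 < b →
                             ¬ IsGeneralPosition G (triple x y z)
  between⇒¬generalPosition {x} {y} {z} {a} β@(xy , yz , xz) 0<a 0<b gp =
    gp x y z (x∈triple x y z) (y∈triple x y z) (z∈triple x y z)
      (distance>0⇒≢ xy 0<a) (distance>0⇒≢ yz 0<b)
      (distance>0⇒≢ xz (≤-trans 0<a (m≤m+n a _)))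
      (between⇒onCommonGeodesic β)

  long-geodesic⇒between : ∀ {k u v d} → Distance G u v d → ¬ d ≤ 2 * k + 1 →
    Σ (Vertex G) λ x → Σ (Vertex G) λ y → Σ (Vertex G) λ z → Σ ℕ λ b →
      Between x y z (suc k) b × k < b
  long-geodesic⇒between {k} {d = d} geodesic@(p , _) d≰2k+1 =
    _ , _ , _ , _ , vertexAt-between p geodesic z≤n 1+k≤d ≤-refl , 1+k≤d∸[1+k]
    where
    2[1+k]≤d : suc k + suc k ≤ d
    2[1+k]≤d = subst (_≤ d) (≡-sym (1+k+1+k≡1+[2k+1] k)) (≰⇒> d≰2k+1)
    1+k≤d : suc k ≤ d
    1+k≤d = ≤-trans (m≤m+n (suc k) (suc k)) 2[1+k]≤d
    1+k≤d∸[1+k] : suc k ≤ d ∸ suc k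
    1+k≤d∸[1+k] = m+n≤o⇒m≤o∸n (suc k) 2[1+k]≤d

  packing⇒generalPosition⇒diam : ∀ {k} → (∀ S → IsKPacking G k S → IsGeneralPosition G S) →
                                 DiamAtMost G (2 * k + 1)
  packing⇒generalPosition⇒diam {k} packing⇒gp u v d uv with d ≤? 2 * k + 1
  ... | yes d≤2k+1 = d≤2k+1
  ... | no d≰2k+1 with long-geodesic⇒between uv d≰2k+1
  ... | _ , _ , _ , _ , β , k<b =
    ⊥-elim (between⇒¬generalPosition β (s≤s z≤n) (≤-trans (s≤s z≤n) k<b)
             (packing⇒gp _ (between-packing β ≤-refl k<b)))

proposition4p1 : (G : Graph) → Connected G → (k : ℕ) → 1 ≤ k →
    (DiamAtMost G (2 * k + 1) ⇔ (∀ (S : Subset (n G)) → IsKPacking G k S → IsGeneralPosition G S))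
proposition4p1 G _ k _ =
  mk⇔ (diam⇒packing⇒generalPosition G) (packing⇒generalPosition⇒diam G)
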